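{- Define $a_1=1$ and, for $d\ge2$, $a_d=(2d-1)!!-\sum_{k=1}^{d-1}(2d-2k-1)!!\,a_k$, where $m!!=m(m-2)\cdots1$ for odd $m\ge1$ and $(-1)!!=1$. Then for all $d\ge4$, \[ (2d-4)(2d-3)!! < a_d < (2d-3)(2d-3)!!. \]
   Context: $a_d$ equals the number of good pair sequences of the $d$-crosspolytope, i.e. sequences $(L_1L_2)\dots(L_{2d-1}L_{2d})$ with $\{L_1,\dots,L_{2d}\}=\{1,\dots,2d\}$, $L_1<L_3<\dots<L_{2d-1}$, $L_{2i-1}<L_{2i}$, and $\{L_1,\dots,L_{2k}\}\neq\{1,\dots,2k\}$ for $0<k<d$; only the recurrence is needed for the claim. -}

module Defs where

open import Data.Nat as ℕ using (ℕ; zero; suc)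
open import Data.Integer using (ℤ; +_; _-_; _*_; _+_)
open import Data.List using (List; []; _∷_; length; reverse)

-- oddDF n = (2n-1)!!, with oddDF 0 = (-1)!! = 1.
oddDF : ℕ → ℕ
oddDF zero    = 1
oddDF (suc n) = (2 ℕ.* n ℕ.+ 1) ℕ.* oddDF n

-- Given the list [a_{d-1}, ..., a_1] (most recent first, length d-1),
-- compute  Σ_{k=1}^{d-1} (2d-2k-1)!! a_k.
-- The j-th element (j = 1..d-1, 1-based) is a_{d-j}, weighted by (2j-1)!! = oddDF j.
weightedSum : ℕ → List ℤ → ℤ
weightedSum j []       = + 0
weightedSum j (x ∷ xs) = + oddDF (suc j) * x + weightedSum (suc j) xs

-- history n = [a_n, a_{n-1}, ..., a_1]
history : ℕ → List ℤ
history zero          = []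
history (suc zero)    = + 1 ∷ []
history (suc (suc n)) =
  let h = history (suc n) in
  (+ oddDF (suc (suc n)) - weightedSum 0 h) ∷ h

-- a d for d ≥ 1 (a 0 is an irrelevant default 0):
-- a_1 = 1, a_d = (2d-1)!! - Σ_{k=1}^{d-1} (2d-2k-1)!! a_k.
a : ℕ → ℤ
a n with history n
... | []    = + 0
... | x ∷ _ = x

module Submission where

-- Write f(n) = (2n-1)!! (= oddDF n) and W_d = Σ_{i=1}^{d-1} f(i) a_{d-i}, so that the
-- recurrence reads a_d = f(d) - W_d.  The proof is an induction on d ≥ 4 that keeps
--   * 0 ≤ a_k ≤ f(k) for every k ≤ d (so everything can be computed in ℕ),
--   * the two bounds of the proposition, (2d-4) f(d-1) < a_d < (2d-3) f(d-1),
--   * the auxiliary bound f(d-1) ≤ 3 a_{d-1}.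
-- In the step W_{d+1} = a_d + 3 a_{d-1} + Σ_{i≥3} f(i) a_{d+1-i}.  The last two terms of
-- that tail, f(d-1)·a_2 + f(d)·a_1 = 2 f(d-1) + f(d), already give 2 f(d) < W_{d+1}.
-- For the upper estimate a_k ≤ f(k) bounds the tail by the same sum of products of
-- double factorials; its middle terms are each at most 15 f(d-2), because f is
-- log-supermodular, and this yields W_{d+1} < 3 f(d).  Since f(d+1) = (2d+1) f(d), the
-- two estimates on W_{d+1} are exactly the bounds for a_{d+1}.

open import Defs
open import Data.Nat using (ℕ; _≤_; _∸_)

module Estimates where
  open import Data.Nat using (zero; suc; _+_; _*_; _<_; z≤n; s≤s)
  open import Data.Nat.Properties
  open import Data.Nat.Tactic.RingSolver using (solve-∀)
  open import Algebra.Properties.CommutativeSemigroup *-commutativeSemigroup using (x∙yz≈y∙xz)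
  open import Data.Integer using (+_; ∣_∣)
  import Data.Integer as ℤ
  import Data.Integer.Properties as ℤₚ
  open import Data.List using (_∷_)
  open import Data.Product using (_×_; _,_; proj₁; proj₂)
  open import Data.Sum using (inj₁; inj₂)
  open import Data.Unit using (tt)
  open import Relation.Binary.PropositionalEquality

  -- Log-supermodularity of the double factorial: for p ≤ n the ratio f(n+k)/f(n)
  -- dominates f(p+k)/f(p), since each factor 2(n+i)+1 dominates 2(p+i)+1.
  oddDF-supermodular : ∀ {p n} → p ≤ n → ∀ k →
                       oddDF n * oddDF (p + k) ≤ oddDF p * oddDF (n + k)
  oddDF-supermodular {p} {n} p≤n zero
    rewrite +-identityʳ p | +-identityʳ n = ≤-reflexive (*-comm (oddDF n) (oddDF p))
  oddDF-supermodular {p} {n} p≤n (suc k)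
    rewrite +-suc p k | +-suc n k = begin
      oddDF n * (cp * oddDF (p + k))  ≡⟨ x∙yz≈y∙xz (oddDF n) cp (oddDF (p + k)) ⟩
      cp * (oddDF n * oddDF (p + k))  ≤⟨ *-monoʳ-≤ cp (oddDF-supermodular p≤n k) ⟩
      cp * (oddDF p * oddDF (n + k))  ≤⟨ *-monoˡ-≤ (oddDF p * oddDF (n + k)) cp≤cn ⟩
      cn * (oddDF p * oddDF (n + k))  ≡⟨ x∙yz≈y∙xz cn (oddDF p) (oddDF (n + k)) ⟩
      oddDF p * (cn * oddDF (n + k))  ∎
    where
    open ≤-Reasoning
    cp cn : ℕ
    cp = 2 * (p + k) + 1
    cn = 2 * (n + k) + 1
    cp≤cn : cp ≤ cn
    cp≤cn = +-monoˡ-≤ 1 (*-monoʳ-≤ 2 (+-monoˡ-≤ k p≤n))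

  -- conv g j m = Σ_{i=1}^{m} f(j+i) · g(m+1-i); thus W_d = conv |a| 0 (d-1).
  conv : (ℕ → ℕ) → ℕ → ℕ → ℕ
  conv g j zero    = 0
  conv g j (suc m) = oddDF (suc j) * g (suc m) + conv g (suc j) m

  conv-mono : ∀ {g h} m → (∀ k → k ≤ m → g k ≤ h k) → ∀ j → conv g j m ≤ conv h j m
  conv-mono zero    g≤h j = z≤n
  conv-mono (suc m) g≤h j =
    +-mono-≤ (*-monoʳ-≤ (oddDF (suc j)) (g≤h (suc m) ≤-refl))
             (conv-mono m (λ k k≤m → g≤h k (m≤n⇒m≤1+n k≤m)) (suc j))

  lastTwo : (ℕ → ℕ) → ℕ → ℕ
  lastTwo g s = oddDF (suc s) * g 2 + oddDF (2 + s) * g 1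

  conv-lastTwo : ∀ g m j →
                 conv g j (2 + m) ≡ conv (λ k → g (2 + k)) j m + lastTwo g (j + m)
  conv-lastTwo g zero j = trans (cong (_+_ (oddDF (suc j) * g 2)) (+-identityʳ _))
                                (cong (lastTwo g) (sym (+-identityʳ j)))
  conv-lastTwo g (suc m) j = begin
    oddDF (suc j) * g (3 + m) + conv g (suc j) (2 + m)
      ≡⟨ cong (_+_ (oddDF (suc j) * g (3 + m))) (conv-lastTwo g m (suc j)) ⟩
    oddDF (suc j) * g (3 + m) + (conv g₂ (suc j) m + lastTwo g (suc j + m))
      ≡⟨ sym (+-assoc (oddDF (suc j) * g (3 + m)) (conv g₂ (suc j) m) _) ⟩
    conv g₂ j (suc m) + lastTwo g (suc (j + m))
      ≡⟨ cong (λ s → conv g₂ j (suc m) + lastTwo g s) (sym (+-suc j m)) ⟩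
    conv g₂ j (suc m) + lastTwo g (j + suc m) ∎
    where
    open ≡-Reasoning
    g₂ : ℕ → ℕ
    g₂ k = g (2 + k)

  conv-firstTwo : ∀ g m → conv g 0 (2 + m) ≡ g (2 + m) + (3 * g (1 + m) + conv g 2 m)
  conv-firstTwo g m = cong (_+ (3 * g (1 + m) + conv g 2 m)) (*-identityˡ (g (2 + m)))

  -- Each middle product f(3+i) f(3+m-i) is at most f(3) f(2+m) = 15 f(2+m), by
  -- supermodularity, so the shifted self-convolution of f is at most 15 m f(2+m).
  conv-oddDF-middle : ∀ m J →
                      conv (λ k → oddDF (2 + k)) (2 + J) m ≤ m * 15 * oddDF (2 + (J + m))
  conv-oddDF-middle zero    J = z≤n
  conv-oddDF-middle (suc m) J rewrite +-suc J m = begin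
    oddDF (3 + J) * oddDF (3 + m) + conv (λ k → oddDF (2 + k)) (3 + J) m
      ≤⟨ +-mono-≤ (oddDF-supermodular (m≤m+n 3 J) m) (conv-oddDF-middle m (suc J)) ⟩
    15 * F + m * 15 * F
      ≡⟨ sym (*-distribʳ-+ F 15 (m * 15)) ⟩
    suc m * 15 * F ∎
    where
    open ≤-Reasoning
    F : ℕ
    F = oddDF (3 + (J + m))

  history-suc : ∀ n → history (suc n) ≡ a (suc n) ∷ history n
  history-suc zero    = refl
  history-suc (suc n) = refl

  weightedSum-history : ∀ {g} m → (∀ k → k ≤ m → a k ≡ + g k) →
                        ∀ j → weightedSum j (history m) ≡ + conv g j m
  weightedSum-history zero    _   j = refl
  weightedSum-history {g} (suc m) a≡g j = begin
    weightedSum j (history (suc m))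
      ≡⟨ cong (weightedSum j) (history-suc m) ⟩
    + oddDF (suc j) ℤ.* a (suc m) ℤ.+ weightedSum (suc j) (history m)
      ≡⟨ cong₂ (λ x y → + oddDF (suc j) ℤ.* x ℤ.+ y) (a≡g (suc m) ≤-refl)
               (weightedSum-history m (λ k k≤m → a≡g k (m≤n⇒m≤1+n k≤m)) (suc j)) ⟩
    + oddDF (suc j) ℤ.* + g (suc m) ℤ.+ + conv g (suc j) m
      ≡⟨ cong (ℤ._+ + conv g (suc j) m) (sym (ℤₚ.pos-* (oddDF (suc j)) (g (suc m)))) ⟩
    + conv g j (suc m) ∎
    where open ≡-Reasoning

  a-next : ∀ {g} n → (∀ k → k ≤ suc n → a k ≡ + g k) → conv g 0 (suc n) ≤ oddDF (2 + n) →
           (a (2 + n) ≡ + ∣ a (2 + n) ∣) × (∣ a (2 + n) ∣ + conv g 0 (suc n) ≡ oddDF (2 + n))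
  a-next {g} n a≡g W≤f = trans a≡ (cong +_ (sym |a|≡)) , trans (cong (_+ W) |a|≡) (m∸n+n≡m W≤f)
    where
    open ≡-Reasoning
    W : ℕ
    W = conv g 0 (suc n)
    a≡ : a (2 + n) ≡ + (oddDF (2 + n) ∸ W)
    a≡ = begin
      + oddDF (2 + n) ℤ.- weightedSum 0 (history (suc n))
        ≡⟨ cong (ℤ._-_ (+ oddDF (2 + n))) (weightedSum-history (suc n) a≡g 0) ⟩
      + oddDF (2 + n) ℤ.- + W   ≡⟨ ℤₚ.m-n≡m⊖n (oddDF (2 + n)) W ⟩
      oddDF (2 + n) ℤ.⊖ W       ≡⟨ ℤₚ.⊖-≥ W≤f ⟩
      + (oddDF (2 + n) ∸ W) ∎
    |a|≡ : ∣ a (2 + n) ∣ ≡ oddDF (2 + n) ∸ W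
    |a|≡ = cong ∣_∣ a≡

  <-by-excess : ∀ {x w p q} → x + w ≡ p + q → w < q → p < x
  <-by-excess {x} {w} {p} {q} eq w<q = +-cancelʳ-< w p x (begin-strict
    p + w  <⟨ +-monoʳ-< p w<q ⟩
    p + q  ≡⟨ sym eq ⟩
    x + w  ∎)
    where open ≤-Reasoning

  <-by-deficit : ∀ {x w p q} → x + w ≡ p + q → q < w → x < p
  <-by-deficit {x} {w} {p} {q} eq q<w = +-cancelʳ-< q x p (begin-strict
    x + q  <⟨ +-monoʳ-< x q<w ⟩
    x + w  ≡⟨ eq ⟩
    p + q  ∎)
    where open ≤-Reasoning

  -- From here on b k = |a_k|, which equals a_k as long as the induction keeps a_k ≥ 0.
  b : ℕ → ℕ
  b k = ∣ a k ∣

  InRange : ℕ → Set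
  InRange k = (a k ≡ + b k) × (b k ≤ oddDF k)

  AllInRange : ℕ → Set
  AllInRange n = ∀ k → k ≤ n → InRange k

  extend : ∀ {n} → AllInRange n → InRange (suc n) → AllInRange (suc n)
  extend all new k k≤1+n with m≤n⇒m<n∨m≡n k≤1+n
  ... | inj₁ (s≤s k≤n) = all k k≤n
  ... | inj₂ refl      = new

  -- The proposition for d = 4 + m (note 2d - 4 = 2m + 4, 2d - 3 = 2m + 5, d - 1 = 3 + m),
  -- and the auxiliary bound f(d-1) ≤ 3 a_{d-1} used for the next step.
  Lower Upper ThirdBound : ℕ → Set
  Lower m      = (2 * m + 4) * oddDF (3 + m) < b (4 + m)
  Upper m      = b (4 + m) < (2 * m + 5) * oddDF (3 + m)
  ThirdBound m = oddDF (3 + m) ≤ 3 * b (3 + m)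

  Invariant : ℕ → Set
  Invariant m = AllInRange (4 + m) × Lower m × Upper m × ThirdBound m

  -- The values a_0..a_4 = 0, 1, 2, 10, 74, checked by evaluation.
  initial : Invariant 0
  initial = inRange , ≤ᵇ⇒≤ _ _ tt , ≤ᵇ⇒≤ _ _ tt , ≤ᵇ⇒≤ _ _ tt
    where
    inRange : AllInRange 4
    inRange 0 _ = refl , z≤n
    inRange 1 _ = refl , ≤ᵇ⇒≤ _ _ tt
    inRange 2 _ = refl , ≤ᵇ⇒≤ _ _ tt
    inRange 3 _ = refl , ≤ᵇ⇒≤ _ _ tt
    inRange 4 _ = refl , ≤ᵇ⇒≤ _ _ tt
    inRange (suc (suc (suc (suc (suc _))))) (s≤s (s≤s (s≤s (s≤s ()))))

  -- Lower estimate: W_{5+m} > (2m+4) f(3+m) + f(3+m) + (2 f(3+m) + f(4+m)) = 2 f(4+m),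
  -- using the current lower bound, the auxiliary bound and a_2 = 2, a_1 = 1.
  sum-lower : ∀ m → Invariant m → 2 * oddDF (4 + m) < conv b 0 (4 + m)
  sum-lower m (_ , lower , _ , third) = begin-strict
    2 * oddDF (4 + m)
      ≡⟨ regroup m (oddDF (3 + m)) ⟩
    (2 * m + 4) * oddDF (3 + m) + (oddDF (3 + m) + lastTwo b (2 + m))
      <⟨ +-mono-<-≤ lower (+-mono-≤ third lastTwo≤tail) ⟩
    b (4 + m) + (3 * b (3 + m) + conv b 2 (2 + m))
      ≡⟨ sym (conv-firstTwo b (2 + m)) ⟩
    conv b 0 (4 + m) ∎
    where
    open ≤-Reasoning
    lastTwo≤tail : lastTwo b (2 + m) ≤ conv b 2 (2 + m)
    lastTwo≤tail = ≤-trans (m≤n+m _ (conv (λ k → b (2 + k)) 2 m))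
                           (≤-reflexive (sym (conv-lastTwo b m 2)))
    regroup : ∀ m x → 2 * ((2 * (3 + m) + 1) * x)
                      ≡ (2 * m + 4) * x + (x + (x * 2 + (2 * (3 + m) + 1) * x * 1))
    regroup = solve-∀

  -- Upper estimate: bounding a_k by f(k) in the tail,
  -- W_{5+m} < (2m+5) f(3+m) + 3 f(3+m) + 15 m f(2+m) + 3 f(3+m) + f(4+m) ≤ 3 f(4+m).
  sum-upper : ∀ m → Invariant m → conv b 0 (4 + m) < 3 * oddDF (4 + m)
  sum-upper m (inRange , _ , upper , _) = begin-strict
    conv b 0 (4 + m)
      ≡⟨ conv-firstTwo b (2 + m) ⟩
    b (4 + m) + (3 * b (3 + m) + conv b 2 (2 + m))
      <⟨ +-mono-<-≤ upper (+-mono-≤ (*-monoʳ-≤ 3 b₃≤) tail≤) ⟩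
    (2 * m + 5) * F₃ + (3 * F₃ + (m * 15 * F₂ + lastTwo oddDF (2 + m)))
      ≤⟨ m≤m+n _ ((4 * m * m + m + 15) * F₂) ⟩
    (2 * m + 5) * F₃ + (3 * F₃ + (m * 15 * F₂ + lastTwo oddDF (2 + m)))
      + (4 * m * m + m + 15) * F₂
      ≡⟨ regroup m F₂ ⟩
    3 * oddDF (4 + m) ∎
    where
    open ≤-Reasoning
    F₂ F₃ : ℕ
    F₂ = oddDF (2 + m)
    F₃ = oddDF (3 + m)
    b₃≤ : b (3 + m) ≤ F₃
    b₃≤ = proj₂ (inRange (3 + m) (n≤1+n _))
    tail≤ : conv b 2 (2 + m) ≤ m * 15 * F₂ + lastTwo oddDF (2 + m)
    tail≤ = begin
      conv b 2 (2 + m)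
        ≤⟨ conv-mono (2 + m) (λ k k≤ → proj₂ (inRange k (≤-trans k≤ (m≤n+m _ 2)))) 2 ⟩
      conv oddDF 2 (2 + m)
        ≡⟨ conv-lastTwo oddDF m 2 ⟩
      conv (λ k → oddDF (2 + k)) 2 m + lastTwo oddDF (2 + m)
        ≤⟨ +-monoˡ-≤ _ (conv-oddDF-middle m 0) ⟩
      m * 15 * F₂ + lastTwo oddDF (2 + m) ∎
    regroup : ∀ m x →
      (2 * m + 5) * ((2 * (2 + m) + 1) * x)
        + (3 * ((2 * (2 + m) + 1) * x)
           + (m * 15 * x + ((2 * (2 + m) + 1) * x * 3
                            + (2 * (3 + m) + 1) * ((2 * (2 + m) + 1) * x) * 1)))
        + (4 * m * m + m + 15) * x
      ≡ 3 * ((2 * (3 + m) + 1) * ((2 * (2 + m) + 1) * x))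
    regroup = solve-∀

  -- The induction step: W_{5+m} < 3 f(4+m) ≤ f(5+m), so a_{5+m} = f(5+m) - W_{5+m} is a
  -- natural number in range, and f(5+m) = (2m+6) f(4+m) + 3 f(4+m) = (2m+7) f(4+m) + 2 f(4+m)
  -- turns the two estimates on W_{5+m} into the two bounds for a_{5+m}.
  step : ∀ m → Invariant m → Invariant (suc m)
  step m inv@(inRange , lower , _ , _) =
    extend inRange (a₅≡b₅ , subst (b (5 + m) ≤_) b₅+W≡F₅ (m≤m+n (b (5 + m)) W)) ,
    <-by-excess (trans b₅+W≡F₅ (split-excess m F₄)) (sum-upper m inv) ,
    <-by-deficit (trans b₅+W≡F₅ (split-deficit m F₄)) (sum-lower m inv) ,
    third
    where
    F₄ W : ℕ
    F₄ = oddDF (4 + m)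
    W  = conv b 0 (4 + m)
    factor≥3 : 3 ≤ 2 * (4 + m) + 1
    factor≥3 = s≤s (s≤s (s≤s z≤n))
    W≤F₅ : W ≤ oddDF (5 + m)
    W≤F₅ = ≤-trans (<⇒≤ (sum-upper m inv)) (*-monoˡ-≤ F₄ factor≥3)
    next : (a (5 + m) ≡ + b (5 + m)) × (b (5 + m) + W ≡ oddDF (5 + m))
    next = a-next (3 + m) (λ k k≤ → proj₁ (inRange k k≤)) W≤F₅
    a₅≡b₅ : a (5 + m) ≡ + b (5 + m)
    a₅≡b₅ = proj₁ next
    b₅+W≡F₅ : b (5 + m) + W ≡ oddDF (5 + m)
    b₅+W≡F₅ = proj₂ next
    split-excess : ∀ m x → (2 * (4 + m) + 1) * x ≡ (2 * suc m + 4) * x + 3 * x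
    split-excess = solve-∀
    split-deficit : ∀ m x → (2 * (4 + m) + 1) * x ≡ (2 * suc m + 5) * x + 2 * x
    split-deficit = solve-∀
    -- f(4+m) = (2m+7) f(3+m) ≤ 3 (2m+4) f(3+m) < 3 a_{4+m}
    third : ThirdBound (suc m)
    third = ≤-trans (≤-trans (m≤m+n F₄ _) (≤-reflexive (sym (triple m (oddDF (3 + m))))))
                    (*-monoʳ-≤ 3 (<⇒≤ lower))
      where
      triple : ∀ m x → 3 * ((2 * m + 4) * x) ≡ (2 * (3 + m) + 1) * x + (4 * m + 5) * x
      triple = solve-∀

  invariant : ∀ m → Invariant m
  invariant zero    = initial
  invariant (suc m) = step m (invariant m)

  bounds : ∀ k → (a (4 + k) ≡ + b (4 + k)) × Lower k × Upper k
  bounds k with invariant k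
  ... | inRange , lower , upper , _ = proj₁ (inRange (4 + k) ≤-refl) , lower , upper

  coefficient-lower : ∀ k → 2 * (4 + k) ∸ 4 ≡ 2 * k + 4
  coefficient-lower k = trans (cong (_∸ 4) (expand k)) (m+n∸n≡m (2 * k + 4) 4)
    where
    expand : ∀ k → 2 * (4 + k) ≡ 2 * k + 4 + 4
    expand = solve-∀

  coefficient-upper : ∀ k → 2 * (4 + k) ∸ 3 ≡ 2 * k + 5
  coefficient-upper k = trans (cong (_∸ 3) (expand k)) (m+n∸n≡m (2 * k + 5) 3)
    where
    expand : ∀ k → 2 * (4 + k) ≡ 2 * k + 5 + 3
    expand = solve-∀

  pos-*-coefficient : ∀ {c c′ x} → c ≡ c′ → + (c′ * x) ≡ + c ℤ.* + x
  pos-*-coefficient {c} {x = x} refl = ℤₚ.pos-* c x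

open import Data.Integer using (ℤ; +_; _*_; _<_)
open import Data.Product using (_×_)

open import Data.Nat using (suc; z≤n; s≤s)
open import Data.Integer using (+<+)
open import Data.Product using (_,_)
open import Relation.Binary.PropositionalEquality using (subst₂; sym)
open Estimates using (bounds; coefficient-lower; coefficient-upper; pos-*-coefficient)

proposition2 : (d : ℕ) → 4 ≤ d →
    (+ (2 Data.Nat.* d ∸ 4) * + oddDF (d ∸ 1) < a d)
    × (a d < + (2 Data.Nat.* d ∸ 3) * + oddDF (d ∸ 1))
proposition2 (suc (suc (suc (suc k)))) (s≤s (s≤s (s≤s (s≤s z≤n)))) with bounds k
... | a≡b , lower , upper =
  subst₂ _<_ (pos-*-coefficient (coefficient-lower k)) (sym a≡b) (+<+ lower) ,
  subst₂ _<_ (sym a≡b) (pos-*-coefficient (coefficient-upper k)) (+<+ upper)
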